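{- Let $G$ be an MP-digraph without coherently oriented cycles (in particular without loops). An edge $e=(v,w)$ of $G$ is a coloop of $M_G$ if and only if $\mathrm{out}_G(v)\le1$ and $\mathrm{in}_G(w)\le1$. In particular, if $e$ is a coloop of $M_G$, then the MP-contraction $G/\!\!/e$ coincides with the classical contraction $G/e$.
   Context: Digraphs: finite, at most one edge $(v,w)$ from $v$ to $w$ for distinct $v,w$. A coherently oriented cycle is a loop or a subgraph with distinct vertices $v_1,\dots,v_n$ ($n\ge2$) and edges $(v_i,v_{i+1})$, $(v_n,v_1)$. A multipath is a spanning subgraph each of whose connected components is a vertex or a simple path (sequence of non-loop edges, target of each = source of next, no repeated vertex, not closing into a cycle); $M_G=(E(G),\mathrm{Mult}(G))$ with multipaths as edge sets. An MP-digraph satisfies (MP1) no subgraph isomorphic to $D_A$ (vertices $v_0,v_1,v_2$, edges $(v_1,v_0),(v_0,v_2),(v_1,v_2)$) or $D_B$ (vertices $v_0,\dots,v_3$, edges $(v_0,v_1),(v_2,v_1),(v_2,v_3)$) or their edge-reversals, and (MP2) every coherently oriented cycle of length $\ge2$ is a connected component. A coloop of a matroid is an element lying in every basis. $\mathrm{out}_G(v)$ and $\mathrm{in}_G(w)$ are outdegree and indegree. MP-contraction $G/\!\!/e$ of $e=(v,w)$: vertices $(V(G)\setminus\{v,w\})\cup\{x\}$; edges $(a,b)$ with $a,b\notin\{v,w\}$ kept; $(a,v)\mapsto(a,x)$, $(w,b)\mapsto(x,b)$; each $(v,a)$, $a\ne w$, and each $(b,w)$, $b\ne v$, becomes a loop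 at $x$. The classical contraction $G/e$ identifies $v$ and $w$ into one vertex and deletes $e$, keeping all other edges with their endpoints relabelled. -}

module Defs where

open import Data.Nat using (ℕ; _≤_)
open import Data.Bool using (Bool; true; false; if_then_else_; _∨_)
open import Data.Fin using (Fin; _≟_)
open import Data.List using (List; []; _∷_; _++_; length; filterᵇ; allFin; concat)
open import Data.List.Membership.Propositional using (_∈_)
open import Data.List.Relation.Unary.All using (All)
open import Data.List.Relation.Unary.Any using (Any)
open import Data.List.Relation.Unary.Unique.Propositional using (Unique)
open import Data.List.Relation.Binary.Permutation.Propositional using (_↭_)
open import Data.Maybe using (Maybe; just; nothing)
open import Data.Product using (Σ; _×_; _,_; ∃₂)
open import Data.Sum using (_⊎_)
open import Relation.Binary.PropositionalEquality using (_≡_; _≢_)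
open import Relation.Nullary using (¬_; does)

-- A finite digraph on vertex set Fin n with at most one edge (a,b) for each
-- ordered pair (loops allowed): its adjacency predicate.
Digraph : ℕ → Set
Digraph n = Fin n → Fin n → Bool

EdgeSet : ℕ → Set
EdgeSet n = Fin n → Fin n → Bool

_⊆ᴱ_ : ∀ {n} → EdgeSet n → EdgeSet n → Set
H ⊆ᴱ K = ∀ a b → H a b ≡ true → K a b ≡ true

out : ∀ {n} → Digraph n → Fin n → ℕ
out {n} G v = length (filterᵇ (λ b → G v b) (allFin n))

inn : ∀ {n} → Digraph n → Fin n → ℕ
inn {n} G w = length (filterᵇ (λ a → G a w) (allFin n))

Consecutive : ∀ {n} → Fin n → Fin n → List (Fin n) → Set
Consecutive a b p = ∃₂ λ xs ys → p ≡ xs ++ (a ∷ b ∷ ys)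

-- A multipath (as an edge set H): the spanning subgraph (Fin n, H) is a
-- disjoint union of components, each a single vertex or a directed simple
-- path.
IsMultipath : ∀ {n} → EdgeSet n → Set
IsMultipath {n} H =
  Σ (List (List (Fin n))) λ ps →
    (concat ps ↭ allFin n) ×
    All (λ p → p ≢ []) ps ×
    (∀ a b → (H a b ≡ true → Any (Consecutive a b) ps)
           × (Any (Consecutive a b) ps → H a b ≡ true))

Independent : ∀ {n} → Digraph n → EdgeSet n → Set
Independent G H = H ⊆ᴱ G × IsMultipath H

IsBasis : ∀ {n} → Digraph n → EdgeSet n → Set
IsBasis G B = Independent G B × (∀ H → Independent G H → B ⊆ᴱ H → H ⊆ᴱ B)

IsColoop : ∀ {n} → Digraph n → Fin n → Fin n → Set
IsColoop G v w = ∀ B → IsBasis G B → B v w ≡ true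

record CycleOfLen≥2 {n} (G : Digraph n) : Set where
  constructor mkCycle
  field
    first : Fin n
    second : Fin n
    rest : List (Fin n)
    distinct : Unique (first ∷ second ∷ rest)
    consecEdges : ∀ a b → Consecutive a b (first ∷ second ∷ rest) → G a b ≡ true
    last : Fin n
    lastIsLast : Σ (List (Fin n)) λ xs → (first ∷ second ∷ rest) ≡ xs ++ (last ∷ [])
    closing : G last first ≡ true
  verts : List (Fin n)
  verts = first ∷ second ∷ rest

CycleEdge : ∀ {n} {G : Digraph n} → CycleOfLen≥2 G → Fin n → Fin n → Set
CycleEdge C a b = Consecutive a b (CycleOfLen≥2.verts C)
                  ⊎ (a ≡ CycleOfLen≥2.last C × b ≡ CycleOfLen≥2.first C)

IsComponent : ∀ {n} {G : Digraph n} → CycleOfLen≥2 G → Set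
IsComponent {n} {G} C = ∀ a b → G a b ≡ true →
  (a ∈ CycleOfLen≥2.verts C ⊎ b ∈ CycleOfLen≥2.verts C) → CycleEdge C a b

ContainsDA : ∀ {n} → Digraph n → Set
ContainsDA {n} G = Σ (Fin n) λ v0 → Σ (Fin n) λ v1 → Σ (Fin n) λ v2 →
  Unique (v0 ∷ v1 ∷ v2 ∷ []) ×
  G v1 v0 ≡ true × G v0 v2 ≡ true × G v1 v2 ≡ true

ContainsDArev : ∀ {n} → Digraph n → Set
ContainsDArev {n} G = Σ (Fin n) λ v0 → Σ (Fin n) λ v1 → Σ (Fin n) λ v2 →
  Unique (v0 ∷ v1 ∷ v2 ∷ []) ×
  G v0 v1 ≡ true × G v2 v0 ≡ true × G v2 v1 ≡ true

ContainsDB : ∀ {n} → Digraph n → Set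
ContainsDB {n} G = Σ (Fin n) λ v0 → Σ (Fin n) λ v1 → Σ (Fin n) λ v2 → Σ (Fin n) λ v3 →
  Unique (v0 ∷ v1 ∷ v2 ∷ v3 ∷ []) ×
  G v0 v1 ≡ true × G v2 v1 ≡ true × G v2 v3 ≡ true

ContainsDBrev : ∀ {n} → Digraph n → Set
ContainsDBrev {n} G = Σ (Fin n) λ v0 → Σ (Fin n) λ v1 → Σ (Fin n) λ v2 → Σ (Fin n) λ v3 →
  Unique (v0 ∷ v1 ∷ v2 ∷ v3 ∷ []) ×
  G v1 v0 ≡ true × G v1 v2 ≡ true × G v3 v2 ≡ true

MP1 : ∀ {n} → Digraph n → Set
MP1 G = ¬ ContainsDA G × ¬ ContainsDArev G × ¬ ContainsDB G × ¬ ContainsDBrev G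

MP2 : ∀ {n} → Digraph n → Set
MP2 G = ∀ (C : CycleOfLen≥2 G) → IsComponent C

IsMPDigraph : ∀ {n} → Digraph n → Set
IsMPDigraph G = MP1 G × MP2 G

NoCoherentCycles : ∀ {n} → Digraph n → Set
NoCoherentCycles G = (∀ v → G v v ≡ false) × ¬ CycleOfLen≥2 G

-- Vertex set of the contracted graph:
-- Maybe (Fin n), where nothing is the new vertex x and just u stands for
-- u ∉ {v,w}.  A contraction is described by the image of each edge
-- f ≠ e of G (edges are kept with their identity, so parallel images are
-- distinguished).
merge : ∀ {n} → Fin n → Fin n → Fin n → Maybe (Fin n)
merge v w u = if does (u ≟ v) ∨ does (u ≟ w) then nothing else just u

classicalImage : ∀ {n} → Fin n → Fin n → Fin n → Fin n → Maybe (Fin n) × Maybe (Fin n)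
classicalImage v w a b = merge v w a , merge v w b

mpImage : ∀ {n} → Fin n → Fin n → Fin n → Fin n → Maybe (Fin n) × Maybe (Fin n)
mpImage v w a b =
  if does (a ≟ v) ∨ does (b ≟ w) then (nothing , nothing) else (merge v w a , merge v w b)

ContractionsCoincide : ∀ {n} → Digraph n → Fin n → Fin n → Set
ContractionsCoincide G v w = ∀ a b → G a b ≡ true → ¬ (a ≡ v × b ≡ w) →
  mpImage v w a b ≡ classicalImage v w a b

{-# OPTIONS --safe #-}
module Submission where

-- When G has no coherently oriented cycles, an edge (x , y) of G can be added
-- to a multipath H exactly when x has no H-successor and y no H-predecessor:
-- x then ends a path of H and y starts one, and these paths differ, since
-- otherwise they would close up with (x , y) into a cycle (or a loop) of G.
-- Hence a greedy pass over all edges extends every multipath to a basis.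
-- If (v , w) is a coloop, extending {(v , a)} to a basis shows a = w, so
-- out(v) ≤ 1, and dually in(w) ≤ 1.  Conversely, if (v , w) is the only edge
-- leaving v and the only one entering w, a basis B missing (v , w) could be
-- enlarged by it.  This condition also rules out the edges (v , a), a ≠ w,
-- and (b , w), b ≠ v, which are exactly those that G//e turns into loops and
-- G/e does not.

open import Defs
open import Data.Nat using (ℕ; _≤_; z≤n; s≤s)
open import Data.Fin using (Fin; _≟_)
open import Data.Fin.Properties using (any?)
open import Data.Bool using (Bool; true; false; _∨_; _∧_)
open import Data.Bool.Properties using (∨-zeroʳ; T-≡) renaming (_≟_ to _≟ᵇ_)
open import Data.List
  using (List; []; _∷_; _++_; [_]; length; filterᵇ; allFin; concat; map; cartesianProduct)
open import Data.List.Properties using (∷ʳ-injectiveʳ; ++-assoc; ++-conicalʳ; concat-map-[_])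
open import Data.List.Membership.Propositional using (_∈_)
open import Data.List.Membership.Propositional.Properties
  using (∈-∃++; ∈-concat⁻′; ∈-++⁻; ∈-allFin; ∈-filter⁺; ∈-filter⁻; ∈-cartesianProduct⁺)
open import Data.List.Relation.Unary.All as All using (All; []; _∷_)
open import Data.List.Relation.Unary.All.Properties as All using ()
open import Data.List.Relation.Unary.Any as Any using (Any; here; there)
open import Data.List.Relation.Unary.Any.Properties as Any using ()
open import Data.List.Relation.Unary.Unique.Propositional using (Unique)
open import Data.List.Relation.Unary.Unique.Propositional.Properties using (allFin⁺; filter⁺)
open import Data.List.Relation.Unary.AllPairs using ([]; _∷_)
open import Data.List.Relation.Binary.Permutation.Propositional
  using (_↭_; refl; prep; swap; trans; ↭-sym; ↭-reflexive; ↭⇒↭ₛ)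
open import Data.List.Relation.Binary.Permutation.Propositional.Properties
  using (All-resp-↭; Any-resp-↭; ∈-resp-↭; shift; shifts; ++⁺ˡ)
import Data.List.Relation.Binary.Permutation.Setoid.Properties as SetoidPerm
open import Data.Product using (_×_; _,_; proj₁; proj₂; map₂; ∃; ∃₂)
open import Data.Sum as Sum using (_⊎_; inj₁; inj₂)
open import Data.Empty using (⊥-elim)
open import Function using (_∘_)
open import Function.Bundles using (Equivalence)
open import Relation.Binary.PropositionalEquality using (_≡_; _≢_; refl; sym; subst; setoid)
  renaming (trans to ≡-trans)
open import Relation.Nullary using (¬_; does; yes; no; contradiction)
open import Relation.Nullary.Decidable using (T?; dec-true)

data Adjacent {A : Set} (a b : A) : List A → Set where
  here  : ∀ {ys} → Adjacent a b (a ∷ b ∷ ys)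
  there : ∀ {z ys} → Adjacent a b ys → Adjacent a b (z ∷ ys)

module _ {A : Set} where

  Unique-resp-↭ : {xs ys : List A} → xs ↭ ys → Unique xs → Unique ys
  Unique-resp-↭ σ = SetoidPerm.Unique-resp-↭ (setoid A) (↭⇒↭ₛ σ)

  Unique-++⁻ˡ : ∀ xs {ys : List A} → Unique (xs ++ ys) → Unique xs
  Unique-++⁻ˡ []       _        = []
  Unique-++⁻ˡ (x ∷ xs) (x∉ ∷ u) = All.++⁻ˡ xs x∉ ∷ Unique-++⁻ˡ xs u

  concat-↭ : {ps qs : List (List A)} → ps ↭ qs → concat ps ↭ concat qs
  concat-↭ refl         = refl
  concat-↭ (prep p σ)   = ++⁺ˡ p (concat-↭ σ)
  concat-↭ (swap p q σ) = trans (shifts p q) (++⁺ˡ q (++⁺ˡ p (concat-↭ σ)))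
  concat-↭ (trans σ τ)  = trans (concat-↭ σ) (concat-↭ τ)

  ∈-concat⇒↭-front : ∀ {x : A} ps → x ∈ concat ps → ∃₂ λ p rest → x ∈ p × ps ↭ p ∷ rest
  ∈-concat⇒↭-front ps x∈ with p , x∈p , p∈ps ← ∈-concat⁻′ ps x∈
                         with h , t , refl ← ∈-∃++ p∈ps
    = p , h ++ t , x∈p , shift p h t

  Adjacent-++⁺ˡ : ∀ {a b : A} {xs ys} → Adjacent a b xs → Adjacent a b (xs ++ ys)
  Adjacent-++⁺ˡ here      = here
  Adjacent-++⁺ˡ (there c) = there (Adjacent-++⁺ˡ c)

  Adjacent-++⁺ʳ : ∀ {a b : A} xs {ys} → Adjacent a b ys → Adjacent a b (xs ++ ys)
  Adjacent-++⁺ʳ []       c = c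
  Adjacent-++⁺ʳ (x ∷ xs) c = there (Adjacent-++⁺ʳ xs c)

  Adjacent-concat⁺ : ∀ {a b : A} {ps} → Any (Adjacent a b) ps → Adjacent a b (concat ps)
  Adjacent-concat⁺              (here c)  = Adjacent-++⁺ˡ c
  Adjacent-concat⁺ {ps = p ∷ _} (there c) = Adjacent-++⁺ʳ p (Adjacent-concat⁺ c)

  Adjacent-junction : ∀ {x y : A} pre {qt} → Adjacent x y ((pre ++ [ x ]) ++ y ∷ qt)
  Adjacent-junction []        = here
  Adjacent-junction (z ∷ pre) = there (Adjacent-junction pre)

  Adjacent-junction⁻ : ∀ {a b x y : A} pre {qt} → Adjacent a b ((pre ++ [ x ]) ++ y ∷ qt) →
    Adjacent a b (pre ++ [ x ]) ⊎ Adjacent a b (y ∷ qt) ⊎ (a ≡ x × b ≡ y)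
  Adjacent-junction⁻ []          here      = inj₂ (inj₂ (refl , refl))
  Adjacent-junction⁻ []          (there c) = inj₂ (inj₁ c)
  Adjacent-junction⁻ (_ ∷ [])    here      = inj₁ here
  Adjacent-junction⁻ (_ ∷ _ ∷ _) here      = inj₁ here
  Adjacent-junction⁻ (_ ∷ pre)   (there c) = Sum.map₁ there (Adjacent-junction⁻ pre c)

  Adjacent⇒∈ˡ : ∀ {a b : A} {xs} → Adjacent a b xs → a ∈ xs
  Adjacent⇒∈ˡ here      = here refl
  Adjacent⇒∈ˡ (there c) = there (Adjacent⇒∈ˡ c)

  Adjacent⇒∈ʳ : ∀ {a b : A} {xs} → Adjacent a b xs → b ∈ xs
  Adjacent⇒∈ʳ here      = there (here refl)
  Adjacent⇒∈ʳ (there c) = there (Adjacent⇒∈ʳ c)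

  Adjacent-∷⇒∈ʳ : ∀ {a b z : A} {xs} → Adjacent a b (z ∷ xs) → b ∈ xs
  Adjacent-∷⇒∈ʳ here      = here refl
  Adjacent-∷⇒∈ʳ (there c) = Adjacent⇒∈ʳ c

  ¬Adjacent-[-] : ∀ {a b x : A} → ¬ Adjacent a b [ x ]
  ¬Adjacent-[-] (there ())

  Unique⇒Adjacent-functional : ∀ {a b c : A} {xs} → Unique xs →
    Adjacent a b xs → Adjacent a c xs → b ≡ c
  Unique⇒Adjacent-functional _        here       here       = refl
  Unique⇒Adjacent-functional (a∉ ∷ _) here       (there c)  = ⊥-elim (All.lookup a∉ (Adjacent⇒∈ˡ c) refl)
  Unique⇒Adjacent-functional (a∉ ∷ _) (there c)  here       = ⊥-elim (All.lookup a∉ (Adjacent⇒∈ˡ c) refl)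
  Unique⇒Adjacent-functional (_ ∷ u)  (there c₁) (there c₂) = Unique⇒Adjacent-functional u c₁ c₂

  Unique⇒Adjacent-injective : ∀ {a b c : A} {xs} → Unique xs →
    Adjacent a c xs → Adjacent b c xs → a ≡ b
  Unique⇒Adjacent-injective _            here       here       = refl
  Unique⇒Adjacent-injective (_ ∷ c∉ ∷ _) here       (there c)  = ⊥-elim (All.lookup c∉ (Adjacent-∷⇒∈ʳ c) refl)
  Unique⇒Adjacent-injective (_ ∷ c∉ ∷ _) (there c)  here       = ⊥-elim (All.lookup c∉ (Adjacent-∷⇒∈ʳ c) refl)
  Unique⇒Adjacent-injective (_ ∷ u)      (there c₁) (there c₂) = Unique⇒Adjacent-injective u c₁ c₂

  no-successor⇒last : ∀ {x : A} {p} → x ∈ p → (∀ z → ¬ Adjacent x z p) → ∃ λ pre → p ≡ pre ++ [ x ]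
  no-successor⇒last {p = _ ∷ []}    (here refl) _    = [] , refl
  no-successor⇒last {p = _ ∷ z ∷ _} (here refl) ¬adj = contradiction here (¬adj z)
  no-successor⇒last {p = z ∷ _}     (there x∈)  ¬adj
    with pre , refl ← no-successor⇒last x∈ (λ u → ¬adj u ∘ there)
    = z ∷ pre , refl

  ∈-tail⇒predecessor : ∀ {y z : A} {t} → y ∈ t → ∃ λ u → Adjacent u y (z ∷ t)
  ∈-tail⇒predecessor (here refl) = _ , here
  ∈-tail⇒predecessor (there y∈)  = map₂ there (∈-tail⇒predecessor y∈)

  no-predecessor⇒head : ∀ {y : A} {q} → y ∈ q → (∀ z → ¬ Adjacent z y q) → ∃ λ t → q ≡ y ∷ t
  no-predecessor⇒head (here refl) _    = _ , refl
  no-predecessor⇒head (there y∈)  ¬adj = contradiction (proj₂ pred) (¬adj (proj₁ pred))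
    where pred = ∈-tail⇒predecessor y∈

length≤1⇒∈-unique : ∀ {A : Set} {xs : List A} {a b} → length xs ≤ 1 → a ∈ xs → b ∈ xs → a ≡ b
length≤1⇒∈-unique {xs = _ ∷ []}    _       (here refl) (here refl) = refl
length≤1⇒∈-unique {xs = _ ∷ _ ∷ _} (s≤s ()) _          _

Unique∧constant⇒length≤1 : ∀ {A : Set} {xs : List A} {w} → Unique xs → (∀ {a} → a ∈ xs → a ≡ w) →
  length xs ≤ 1
Unique∧constant⇒length≤1 {xs = []}        _               _     = z≤n
Unique∧constant⇒length≤1 {xs = _ ∷ []}    _               _     = s≤s z≤n
Unique∧constant⇒length≤1 {xs = _ ∷ _ ∷ _} ((x≢y ∷ _) ∷ _) const =
  contradiction (≡-trans (const (here refl)) (sym (const (there (here refl))))) x≢y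

module _ {n : ℕ} {f : Fin n → Bool} where

  count≤1⇒unique : ∀ {a b} → length (filterᵇ f (allFin n)) ≤ 1 → f a ≡ true → f b ≡ true → a ≡ b
  count≤1⇒unique {a} {b} count≤1 fa fb =
    length≤1⇒∈-unique count≤1 (selected (∈-allFin a) fa) (selected (∈-allFin b) fb)
    where
    selected : ∀ {x xs} → x ∈ xs → f x ≡ true → x ∈ filterᵇ f xs
    selected x∈ fx = ∈-filter⁺ (T? ∘ f) x∈ (Equivalence.from T-≡ fx)

  unique⇒count≤1 : ∀ {w} → (∀ {a} → f a ≡ true → a ≡ w) → length (filterᵇ f (allFin n)) ≤ 1
  unique⇒count≤1 onlyW = Unique∧constant⇒length≤1 (filter⁺ (T? ∘ f) (allFin⁺ n))
    (λ a∈ → onlyW (Equivalence.to T-≡ (proj₂ (∈-filter⁻ (T? ∘ f) {xs = allFin n} a∈))))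

module _ {n : ℕ} where

  Consecutive⇒Adjacent : ∀ {a b : Fin n} {p} → Consecutive a b p → Adjacent a b p
  Consecutive⇒Adjacent (xs , ys , refl) = Adjacent-++⁺ʳ xs here

  Adjacent⇒Consecutive : ∀ {a b : Fin n} {p} → Adjacent a b p → Consecutive a b p
  Adjacent⇒Consecutive here = [] , _ , refl
  Adjacent⇒Consecutive {p = z ∷ _} (there c) with xs , ys , refl ← Adjacent⇒Consecutive c
    = z ∷ xs , ys , refl

  record PathPartition (H : EdgeSet n) (ps : List (List (Fin n))) : Set where
    field
      covers        : concat ps ↭ allFin n
      nonEmpty      : All (_≢ []) ps
      edge⇒adjacent : ∀ {a b} → H a b ≡ true → Any (Adjacent a b) ps
      adjacent⇒edge : ∀ {a b} → Any (Adjacent a b) ps → H a b ≡ true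

    unique : Unique (concat ps)
    unique = Unique-resp-↭ (↭-sym covers) (allFin⁺ n)

    member : ∀ x → x ∈ concat ps
    member x = ∈-resp-↭ (↭-sym covers) (∈-allFin x)

  open PathPartition

  IsMultipath⇒PathPartition : ∀ {H} → IsMultipath H → ∃ (PathPartition H)
  IsMultipath⇒PathPartition (ps , cover , nonEmpty , edges) = ps , record
    { covers        = cover
    ; nonEmpty      = nonEmpty
    ; edge⇒adjacent = Any.map Consecutive⇒Adjacent ∘ proj₁ (edges _ _)
    ; adjacent⇒edge = proj₂ (edges _ _) ∘ Any.map Adjacent⇒Consecutive
    }

  PathPartition⇒IsMultipath : ∀ {H ps} → PathPartition H ps → IsMultipath H
  PathPartition⇒IsMultipath {ps = ps} part = ps , covers part , nonEmpty part ,
    λ a b → Any.map Adjacent⇒Consecutive ∘ edge⇒adjacent part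
          , adjacent⇒edge part ∘ Any.map Consecutive⇒Adjacent

  PathPartition-resp-↭ : ∀ {H ps qs} → ps ↭ qs → PathPartition H ps → PathPartition H qs
  PathPartition-resp-↭ σ part = record
    { covers        = trans (concat-↭ (↭-sym σ)) (covers part)
    ; nonEmpty      = All-resp-↭ σ (nonEmpty part)
    ; edge⇒adjacent = Any-resp-↭ σ ∘ edge⇒adjacent part
    ; adjacent⇒edge = adjacent⇒edge part ∘ Any-resp-↭ (↭-sym σ)
    }

  successor-unique : ∀ {H} → IsMultipath H → ∀ {a b c} → H a b ≡ true → H a c ≡ true → b ≡ c
  successor-unique mp hab hac with _ , part ← IsMultipath⇒PathPartition mp =
    Unique⇒Adjacent-functional (unique part)
      (Adjacent-concat⁺ (edge⇒adjacent part hab)) (Adjacent-concat⁺ (edge⇒adjacent part hac))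

  predecessor-unique : ∀ {H} → IsMultipath H → ∀ {a b c} → H a c ≡ true → H b c ≡ true → a ≡ b
  predecessor-unique mp hac hbc with _ , part ← IsMultipath⇒PathPartition mp =
    Unique⇒Adjacent-injective (unique part)
      (Adjacent-concat⁺ (edge⇒adjacent part hac)) (Adjacent-concat⁺ (edge⇒adjacent part hbc))

  ∅ᴱ : EdgeSet n
  ∅ᴱ _ _ = false

  ∅ᴱ-isMultipath : IsMultipath ∅ᴱ
  ∅ᴱ-isMultipath = PathPartition⇒IsMultipath {ps = map [_] (allFin n)} record
    { covers        = ↭-reflexive (concat-map-[_] (allFin n))
    ; nonEmpty      = All.map⁺ (All.universal (λ _ ()) (allFin n))
    ; edge⇒adjacent = λ ()
    ; adjacent⇒edge = ⊥-elim ∘ ¬Adjacent-[-] ∘ proj₂ ∘ Any.satisfied ∘ Any.map⁻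
    }

  addEdge : EdgeSet n → Fin n → Fin n → EdgeSet n
  addEdge H x y a b = H a b ∨ (does (a ≟ x) ∧ does (b ≟ y))

  addEdge-new : ∀ H x y → addEdge H x y x y ≡ true
  addEdge-new H x y rewrite dec-true (x ≟ x) refl | dec-true (y ≟ y) refl = ∨-zeroʳ (H x y)

  module _ {H : EdgeSet n} {x y : Fin n} where

    addEdge⁻ : ∀ {a b} → addEdge H x y a b ≡ true → H a b ≡ true ⊎ (a ≡ x × b ≡ y)
    addEdge⁻ {a} {b} with H a b | a ≟ x | b ≟ y
    ... | true  | _       | _       = λ _ → inj₁ refl
    ... | false | yes a≡x | yes b≡y = λ _ → inj₂ (a≡x , b≡y)
    ... | false | yes _   | no _    = λ ()
    ... | false | no _    | _       = λ ()

    ⊆-addEdge : H ⊆ᴱ addEdge H x y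
    ⊆-addEdge _ _ hab rewrite hab = refl

    addEdge-⊆ : ∀ {G : Digraph n} → H ⊆ᴱ G → G x y ≡ true → addEdge H x y ⊆ᴱ G
    addEdge-⊆ H⊆G gxy a b e with addEdge⁻ e
    ... | inj₁ hab           = H⊆G a b hab
    ... | inj₂ (refl , refl) = gxy

    PathPartition-join : ∀ pre {qt rest} → PathPartition H ((pre ++ [ x ]) ∷ (y ∷ qt) ∷ rest) →
      PathPartition (addEdge H x y) (((pre ++ [ x ]) ++ y ∷ qt) ∷ rest)
    PathPartition-join pre {qt} {rest} part = record
      { covers        = subst (_↭ allFin n) (sym (++-assoc (pre ++ [ x ]) (y ∷ qt) (concat rest)))
                              (covers part)
      ; nonEmpty      = (λ e → contradiction (++-conicalʳ (pre ++ [ x ]) (y ∷ qt) e) λ ())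
                        ∷ All.tail (All.tail (nonEmpty part))
      ; edge⇒adjacent = to
      ; adjacent⇒edge = from
      }
      where
      to : ∀ {a b} → addEdge H x y a b ≡ true → Any (Adjacent a b) (((pre ++ [ x ]) ++ y ∷ qt) ∷ rest)
      to e with addEdge⁻ e
      ... | inj₂ (refl , refl) = here (Adjacent-junction pre)
      ... | inj₁ hab with edge⇒adjacent part hab
      ...   | here c           = here (Adjacent-++⁺ˡ c)
      ...   | there (here c)   = here (Adjacent-++⁺ʳ (pre ++ [ x ]) c)
      ...   | there (there cs) = there cs
      from : ∀ {a b} → Any (Adjacent a b) (((pre ++ [ x ]) ++ y ∷ qt) ∷ rest) → addEdge H x y a b ≡ true
      from {a} {b} (there cs) = ⊆-addEdge a b (adjacent⇒edge part (there (there cs)))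
      from {a} {b} (here c) with Adjacent-junction⁻ pre c
      ... | inj₁ c′                  = ⊆-addEdge a b (adjacent⇒edge part (here c′))
      ... | inj₂ (inj₁ c′)           = ⊆-addEdge a b (adjacent⇒edge part (there (here c′)))
      ... | inj₂ (inj₂ (refl , refl)) = addEdge-new H x y

  HasSuccessor : EdgeSet n → Fin n → Set
  HasSuccessor H x = ∃ λ z → H x z ≡ true

  HasPredecessor : EdgeSet n → Fin n → Set
  HasPredecessor H y = ∃ λ z → H z y ≡ true

  NoCoherentCycles⇒¬closing-edge : ∀ {G : Digraph n} → NoCoherentCycles G → ∀ {y t pre x} →
    Unique (y ∷ t) → (∀ {a b} → Adjacent a b (y ∷ t) → G a b ≡ true) →
    y ∷ t ≡ pre ++ [ x ] → G x y ≢ true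
  NoCoherentCycles⇒¬closing-edge (noLoop , _) {y} {[]} {pre} _ _ eq gxy
    with refl ← ∷ʳ-injectiveʳ [] pre eq = contradiction (≡-trans (sym gxy) (noLoop y)) λ ()
  NoCoherentCycles⇒¬closing-edge (_ , noCycle) {y} {c ∷ r} {pre} {x} u edges eq gxy =
    noCycle (mkCycle y c r u (λ _ _ → edges ∘ Consecutive⇒Adjacent) x (pre , eq) gxy)

  addEdge-isMultipath : ∀ {G : Digraph n} {H x y} → NoCoherentCycles G → H ⊆ᴱ G → IsMultipath H →
    G x y ≡ true → ¬ HasSuccessor H x → ¬ HasPredecessor H y → IsMultipath (addEdge H x y)
  addEdge-isMultipath {x = x} {y} acyclic H⊆G mp gxy noSucc noPred
    with ps , part ← IsMultipath⇒PathPartition mp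
    with p , rest , x∈p , σ ← ∈-concat⇒↭-front ps (member part x)
    with partₚ ← PathPartition-resp-↭ σ part
    with pre , refl ← no-successor⇒last x∈p (λ z c → noSucc (z , adjacent⇒edge partₚ (here c)))
    with ∈-++⁻ (pre ++ [ x ]) (member partₚ y)
  ... | inj₁ y∈p
    with t , p≡y∷t ← no-predecessor⇒head y∈p (λ z c → noPred (z , adjacent⇒edge partₚ (here c)))
    = contradiction gxy (NoCoherentCycles⇒¬closing-edge acyclic
        (subst Unique p≡y∷t (Unique-++⁻ˡ _ (unique partₚ)))
        (λ c → H⊆G _ _ (adjacent⇒edge partₚ (here (subst (Adjacent _ _) (sym p≡y∷t) c))))
        (sym p≡y∷t))
  ... | inj₂ y∈rest
    with q , rest′ , y∈q , τ ← ∈-concat⇒↭-front rest y∈rest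
    with partₚq ← PathPartition-resp-↭ (prep _ τ) partₚ
    with qt , refl ← no-predecessor⇒head y∈q (λ z c → noPred (z , adjacent⇒edge partₚq (there (here c))))
    = PathPartition⇒IsMultipath (PathPartition-join pre partₚq)

  Blocked : EdgeSet n → Fin n → Fin n → Set
  Blocked K x y = K x y ≡ true ⊎ HasSuccessor K x ⊎ HasPredecessor K y

  Blocked-mono : ∀ {K L x y} → K ⊆ᴱ L → Blocked K x y → Blocked L x y
  Blocked-mono K⊆L (inj₁ kxy)              = inj₁ (K⊆L _ _ kxy)
  Blocked-mono K⊆L (inj₂ (inj₁ (z , kxz))) = inj₂ (inj₁ (z , K⊆L _ _ kxz))
  Blocked-mono K⊆L (inj₂ (inj₂ (z , kzy))) = inj₂ (inj₂ (z , K⊆L _ _ kzy))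

  ⊆ᴱ-refl : ∀ {H : EdgeSet n} → H ⊆ᴱ H
  ⊆ᴱ-refl _ _ h = h

  ⊆ᴱ-trans : ∀ {H K L : EdgeSet n} → H ⊆ᴱ K → K ⊆ᴱ L → H ⊆ᴱ L
  ⊆ᴱ-trans H⊆K K⊆L a b = K⊆L a b ∘ H⊆K a b

module _ {n : ℕ} {G : Digraph n} where

  blocking⇒basis : ∀ {B} → Independent G B → (∀ x y → G x y ≡ true → Blocked B x y) → IsBasis G B
  blocking⇒basis {B} indep blocked = indep , maximal
    where
    maximal : ∀ H → Independent G H → B ⊆ᴱ H → H ⊆ᴱ B
    maximal H (H⊆G , mp) B⊆H a b hab with blocked a b (H⊆G a b hab)
    ... | inj₁ bab              = bab
    ... | inj₂ (inj₁ (z , baz)) =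
      subst (λ u → B a u ≡ true) (successor-unique mp (B⊆H a z baz) hab) baz
    ... | inj₂ (inj₂ (z , bzb)) =
      subst (λ u → B u b ≡ true) (predecessor-unique mp (B⊆H z b bzb) hab) bzb

  module _ (acyclic : NoCoherentCycles G) where

    addEdge-independent : ∀ {H x y} → Independent G H → G x y ≡ true →
      ¬ HasSuccessor H x → ¬ HasPredecessor H y → Independent G (addEdge H x y)
    addEdge-independent (H⊆G , mp) gxy noSucc noPred =
      addEdge-⊆ H⊆G gxy , addEdge-isMultipath acyclic H⊆G mp gxy noSucc noPred

    extend-to-block : ∀ {H} → Independent G H → ∀ x y →
      ∃ λ K → Independent G K × H ⊆ᴱ K × (G x y ≡ true → Blocked K x y)
    extend-to-block {H} indep x y
      with any? (λ z → H x z ≟ᵇ true) | any? (λ z → H z y ≟ᵇ true) | G x y ≟ᵇ true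
    ... | yes succ  | _         | _       = H , indep , ⊆ᴱ-refl , λ _ → inj₂ (inj₁ succ)
    ... | no _      | yes pred  | _       = H , indep , ⊆ᴱ-refl , λ _ → inj₂ (inj₂ pred)
    ... | no _      | no _      | no ¬gxy = H , indep , ⊆ᴱ-refl , λ gxy → contradiction gxy ¬gxy
    ... | no noSucc | no noPred | yes gxy =
      addEdge H x y , addEdge-independent indep gxy noSucc noPred , ⊆-addEdge ,
      λ _ → inj₁ (addEdge-new H x y)

    extend-to-block-all : ∀ {H} → Independent G H → ∀ es →
      ∃ λ K → Independent G K × H ⊆ᴱ K × (∀ {x y} → (x , y) ∈ es → G x y ≡ true → Blocked K x y)
    extend-to-block-all indep [] = _ , indep , ⊆ᴱ-refl , λ ()
    extend-to-block-all indep ((x , y) ∷ es)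
      with K , indepK , H⊆K , blockedK ← extend-to-block indep x y
      with L , indepL , K⊆L , blockedL ← extend-to-block-all indepK es
      = L , indepL , ⊆ᴱ-trans H⊆K K⊆L , λ { (here refl) → Blocked-mono K⊆L ∘ blockedK
                                          ; (there e∈) → blockedL e∈ }

    extend-to-basis : ∀ {H} → Independent G H → ∃ λ B → IsBasis G B × H ⊆ᴱ B
    extend-to-basis indep
      with B , indepB , H⊆B , blockedB ← extend-to-block-all indep (cartesianProduct (allFin n) (allFin n))
      = B , blocking⇒basis indepB (λ x y → blockedB (∈-cartesianProduct⁺ (∈-allFin x) (∈-allFin y)))
      , H⊆B

    edge-independent : ∀ {x y} → G x y ≡ true → Independent G (addEdge ∅ᴱ x y)
    edge-independent gxy = addEdge-independent ((λ _ _ ()) , ∅ᴱ-isMultipath) gxy (λ ()) (λ ())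

ExclusiveEdge : ∀ {n} → Digraph n → Fin n → Fin n → Set
ExclusiveEdge G v w = (∀ {a} → G v a ≡ true → a ≡ w) × (∀ {b} → G b w ≡ true → b ≡ v)

module _ {n : ℕ} {G : Digraph n} {v w : Fin n} where

  coloop⇒exclusive : NoCoherentCycles G → IsColoop G v w → ExclusiveEdge G v w
  coloop⇒exclusive acyclic coloop = onlySucc , onlyPred
    where
    onlySucc : ∀ {a} → G v a ≡ true → a ≡ w
    onlySucc {a} gva with B , basis , single⊆B ← extend-to-basis acyclic (edge-independent acyclic gva)
      = successor-unique (proj₂ (proj₁ basis)) (single⊆B v a (addEdge-new ∅ᴱ v a))
          (coloop B basis)
    onlyPred : ∀ {b} → G b w ≡ true → b ≡ v
    onlyPred {b} gbw with B , basis , single⊆B ← extend-to-basis acyclic (edge-independent acyclic gbw)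
      = predecessor-unique (proj₂ (proj₁ basis)) (single⊆B b w (addEdge-new ∅ᴱ b w))
          (coloop B basis)

  exclusive⇒coloop : NoCoherentCycles G → G v w ≡ true → ExclusiveEdge G v w → IsColoop G v w
  exclusive⇒coloop acyclic gvw (onlySucc , onlyPred) B (indep@(B⊆G , _) , maximal) with B v w ≟ᵇ true
  ... | yes bvw = bvw
  ... | no ¬bvw = maximal (addEdge B v w) (addEdge-independent acyclic indep gvw noSucc noPred)
                          ⊆-addEdge v w (addEdge-new B v w)
    where
    noSucc : ¬ HasSuccessor B v
    noSucc (z , bvz) = ¬bvw (subst (λ u → B v u ≡ true) (onlySucc (B⊆G v z bvz)) bvz)
    noPred : ¬ HasPredecessor B w
    noPred (z , bzw) = ¬bvw (subst (λ u → B u w ≡ true) (onlyPred (B⊆G z w bzw)) bzw)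

  exclusive⇒degrees≤1 : ExclusiveEdge G v w → out G v ≤ 1 × inn G w ≤ 1
  exclusive⇒degrees≤1 (onlySucc , onlyPred) = unique⇒count≤1 onlySucc , unique⇒count≤1 onlyPred

  degrees≤1⇒exclusive : G v w ≡ true → out G v ≤ 1 × inn G w ≤ 1 → ExclusiveEdge G v w
  degrees≤1⇒exclusive gvw (out≤1 , inn≤1) =
    (λ gva → count≤1⇒unique out≤1 gva gvw) , (λ gbw → count≤1⇒unique inn≤1 gbw gvw)

  exclusive⇒contractionsCoincide : ExclusiveEdge G v w → ContractionsCoincide G v w
  exclusive⇒contractionsCoincide (onlySucc , onlyPred) a b gab ab≢vw with a ≟ v | b ≟ w
  ... | yes refl | _        = contradiction (refl , onlySucc gab) ab≢vw
  ... | no a≢v   | yes refl = contradiction (onlyPred gab) a≢v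
  ... | no _     | no _     = refl

lemma5p8 : ∀ {n} (G : Digraph n) → IsMPDigraph G → NoCoherentCycles G →
    ∀ (v w : Fin n) → G v w ≡ true →
      ((IsColoop G v w → out G v ≤ 1 × inn G w ≤ 1)
        × (out G v ≤ 1 × inn G w ≤ 1 → IsColoop G v w))
      × (IsColoop G v w → ContractionsCoincide G v w)
lemma5p8 G _ acyclic v w gvw =
    ( exclusive⇒degrees≤1 ∘ coloop⇒exclusive acyclic
    , exclusive⇒coloop acyclic gvw ∘ degrees≤1⇒exclusive gvw )
  , exclusive⇒contractionsCoincide ∘ coloop⇒exclusive acyclic
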